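{- Let $n,s,k$ be integers with $1\le s\le n$ and $1\le k\le s-1$. Then $$p_{n;\le s;k}=\sum_{i=1}^{s-k}\binom{n}{n-s+i+k}\,p_{s-i-k,\,s-i-1;\le s-i-1}\;p_{n-s+i+k;\le i}.$$
   Context: Parking model: there are $m$ parking spaces in a line, numbered $1,\dots,m$. A preference set of length $n$ is a sequence $(a_1,\dots,a_n)$ of integers with $1\le a_i\le m$; cars $1,\dots,n$ arrive in order, car $i$ parks in the first unoccupied space numbered $\ge a_i$ if one exists, otherwise it fails to park. A $k$-flaw preference set is one in which exactly $k$ cars fail to park; a $0$-flaw one is a parking function. $p_{n,m;\le s;k}$ denotes the number of $k$-flaw preference sets of length $n$ with $m$ spaces and all $a_i\le s$. Conventions: if $k$ is omitted then $k=0$; if $m$ is omitted then $m=n$. Thus $p_{n;\le s;k}$ counts $k$-flaw preference sets of length $n$ with $n$ spaces and all entries $\le s$, $p_{j,m;\le t}$ counts parking functions of length $j$ with $m$ spaces and entries $\le t$, and $p_{j;\le t}$ counts parking functions of length $j$ with $j$ spaces and entries $\le t$. The empty sequence counts as a parking function (so e.g. $p_{0,m;\le t}=1$). -}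

module Defs where

open import Data.Nat using (ℕ; zero; suc; _+_; _∸_; _≟_)
open import Data.Bool using (Bool; true; false)
open import Data.Product using (_×_; _,_)
open import Data.List using (List; []; _∷_; map; concatMap; length; filter; sum; replicate; upTo)
open import Relation.Nullary.Decidable using (⌊_⌋)
open import Data.Nat.Combinatorics using (_C_)

-- A parking lot state is a list of booleans; the j-th entry (0-indexed)
-- is true iff space j+1 is occupied.

parkFrom : ℕ → List Bool → List Bool × Bool
parkFrom _       []            = [] , false
parkFrom zero    (false ∷ st)  = true ∷ st , true
parkFrom zero    (true ∷ st)   with parkFrom zero st
... | st' , b = true ∷ st' , b
parkFrom (suc d) (o ∷ st)      with parkFrom d st
... | st' , b = o ∷ st' , b

failsFrom : List Bool → List ℕ → ℕ
failsFrom st []       = 0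
failsFrom st (a ∷ as) with parkFrom (a ∸ 1) st
... | st' , true  = failsFrom st' as
... | st' , false = suc (failsFrom st' as)

flaws : ℕ → List ℕ → ℕ
flaws m as = failsFrom (replicate m false) as

seqs : ℕ → ℕ → List (List ℕ)
seqs zero    s = [] ∷ []
seqs (suc n) s = concatMap (λ a → map (a ∷_) (seqs n s)) (map suc (upTo s))

-- p_{n,m;≤s;k}: number of k-flaw preference sets of length n with m spaces
-- and all entries ≤ s (entries are also required to be ≥ 1 and ≤ m).
pk : ℕ → ℕ → ℕ → ℕ → ℕ
pk n m s k = length (filter (λ as → flaws m as ≟ k) (seqs n (Data.Nat._⊓_ s m)))
  where import Data.Nat

pnsk : ℕ → ℕ → ℕ → ℕ
pnsk n s k = pk n n s k

pjm : ℕ → ℕ → ℕ → ℕ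
pjm j m t = pk j m t 0

pj : ℕ → ℕ → ℕ
pj j t = pk j j t 0

sumFrom1 : ℕ → (ℕ → ℕ) → ℕ
sumFrom1 zero    f = 0
sumFrom1 (suc N) f = sumFrom1 N f + f (suc N)

-- In the final configuration of a k-flaw preference set on n spaces exactly k ≥ 1 spaces stay
-- empty; let s − i be the last of them.  No car prefers it, so the cars preferring earlier
-- spaces never pass it and form a parking function of length s − i − k on s − i − 1 spaces.
-- The other n − s + i + k cars prefer later spaces, fill all n − s + i of them and overflow k
-- times; as their preferences (shifted by s − i) are at most i, appending k spaces makes them a
-- parking function of length n − s + i + k.  Conversely, any two such words, interleaved in one
-- of C(n, n − s + i + k) ways, give a k-flaw preference set whose last empty space is s − i.

module Submission where

open import Algebra.Properties.CommutativeSemigroup using (interchange)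
open import Data.Bool using (Bool; true; false)
open import Data.List using (List; []; _∷_; _++_; length; map; filter; replicate; concatMap; applyUpTo; upTo)
open import Data.List.Properties
  using (length-++; length-replicate; filter-++; filter-accept; filter-reject; map-upTo; map-applyUpTo; ∷-injectiveʳ)
open import Data.List.Relation.Unary.All as All using (All; []; _∷_; all?)
open import Data.Nat
open import Data.Nat.Combinatorics using (_C_; k>n⇒nCk≡0; nCk+nC[k+1]≡[n+1]C[k+1])
open import Data.Nat.ListAction using (sum)
open import Data.Nat.Properties
open import Data.Product using (_×_; _,_; proj₁; proj₂; Σ-syntax; ∃-syntax)
open import Data.Empty using (⊥-elim)
open import Function using (_∘_)
open import Relation.Binary.Definitions using (tri<; tri≈; tri>)
open import Relation.Binary.PropositionalEquality
open import Relation.Nullary using (Dec; _because_; yes; no; ¬_; ¬?; contradiction)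
open import Relation.Nullary.Decidable using (decidable-stable)
open import Relation.Unary using (Pred; Decidable)

open import Defs

-- Sums over ranges and over words

indicator : ∀ {p} {P : Set p} → Dec P → ℕ
indicator (true because _) = 1
indicator (false because _) = 0

module _ {p} {P : Set p} where

  indicator-yes : (P? : Dec P) → P → indicator P? ≡ 1
  indicator-yes (yes _) _ = refl
  indicator-yes (no ¬p) p = contradiction p ¬p

  indicator-no : (P? : Dec P) → ¬ P → indicator P? ≡ 0
  indicator-no (yes p) ¬p = contradiction p ¬p
  indicator-no (no _) _ = refl

  indicator-≢0 : (P? : Dec P) → indicator P? ≢ 0 → P
  indicator-≢0 (yes p) _ = p
  indicator-≢0 (no _) ≢0 = contradiction refl ≢0

sumBelow : ℕ → (ℕ → ℕ) → ℕ
sumBelow zero g = 0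
sumBelow (suc s) g = g 0 + sumBelow s (g ∘ suc)

sumBelow-cong : ∀ s {g h : ℕ → ℕ} → (∀ x → x < s → g x ≡ h x) → sumBelow s g ≡ sumBelow s h
sumBelow-cong zero g≡h = refl
sumBelow-cong (suc s) g≡h =
  cong₂ _+_ (g≡h 0 z<s) (sumBelow-cong s (λ x x<s → g≡h (suc x) (s<s x<s)))

sumBelow-zero : ∀ s → sumBelow s (λ _ → 0) ≡ 0
sumBelow-zero zero = refl
sumBelow-zero (suc s) = sumBelow-zero s

sumBelow-+ : ∀ s (g h : ℕ → ℕ) → sumBelow s (λ x → g x + h x) ≡ sumBelow s g + sumBelow s h
sumBelow-+ zero g h = refl
sumBelow-+ (suc s) g h = begin
  (g 0 + h 0) + sumBelow s (λ x → g (suc x) + h (suc x))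
    ≡⟨ cong (g 0 + h 0 +_) (sumBelow-+ s (g ∘ suc) (h ∘ suc)) ⟩
  (g 0 + h 0) + (sumBelow s (g ∘ suc) + sumBelow s (h ∘ suc))
    ≡⟨ interchange +-commutativeSemigroup (g 0) (h 0) _ _ ⟩
  (g 0 + sumBelow s (g ∘ suc)) + (h 0 + sumBelow s (h ∘ suc)) ∎
  where open ≡-Reasoning

sumBelow-*ˡ : ∀ s c (g : ℕ → ℕ) → sumBelow s (λ x → c * g x) ≡ c * sumBelow s g
sumBelow-*ˡ zero c g = sym (*-zeroʳ c)
sumBelow-*ˡ (suc s) c g =
  trans (cong (c * g 0 +_) (sumBelow-*ˡ s c (g ∘ suc))) (sym (*-distribˡ-+ c (g 0) _))

sumBelow-*ʳ : ∀ s c (g : ℕ → ℕ) → sumBelow s (λ x → g x * c) ≡ sumBelow s g * c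
sumBelow-*ʳ s c g = begin
  sumBelow s (λ x → g x * c)  ≡⟨ sumBelow-cong s (λ x _ → *-comm (g x) c) ⟩
  sumBelow s (λ x → c * g x)  ≡⟨ sumBelow-*ˡ s c g ⟩
  c * sumBelow s g            ≡⟨ *-comm c _ ⟩
  sumBelow s g * c            ∎
  where open ≡-Reasoning

sumBelow-split : ∀ a b (g : ℕ → ℕ) → sumBelow (a + b) g ≡ sumBelow a g + sumBelow b (λ x → g (a + x))
sumBelow-split zero b g = refl
sumBelow-split (suc a) b g =
  trans (cong (g 0 +_) (sumBelow-split a b (g ∘ suc))) (sym (+-assoc (g 0) _ _))

sumFrom1-cong : ∀ N {g h : ℕ → ℕ} → (∀ i → 1 ≤ i → i ≤ N → g i ≡ h i) → sumFrom1 N g ≡ sumFrom1 N h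
sumFrom1-cong zero g≡h = refl
sumFrom1-cong (suc N) g≡h =
  cong₂ _+_ (sumFrom1-cong N (λ i 1≤i i≤N → g≡h i 1≤i (m≤n⇒m≤1+n i≤N))) (g≡h (suc N) (s≤s z≤n) ≤-refl)

sumFrom1-zero : ∀ N {g : ℕ → ℕ} → (∀ i → 1 ≤ i → i ≤ N → g i ≡ 0) → sumFrom1 N g ≡ 0
sumFrom1-zero zero g≡0 = refl
sumFrom1-zero (suc N) g≡0 =
  cong₂ _+_ (sumFrom1-zero N (λ i 1≤i i≤N → g≡0 i 1≤i (m≤n⇒m≤1+n i≤N))) (g≡0 (suc N) (s≤s z≤n) ≤-refl)

sumFrom1-single : ∀ N {g : ℕ → ℕ} i₀ → 1 ≤ i₀ → i₀ ≤ N → g i₀ ≡ 1 →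
                  (∀ i → 1 ≤ i → i ≤ N → i ≢ i₀ → g i ≡ 0) → sumFrom1 N g ≡ 1
sumFrom1-single zero _ () z≤n _ _
sumFrom1-single (suc N) i₀ 1≤i₀ i₀≤1+N gi₀≡1 others with i₀ ≟ suc N
... | yes refl = cong₂ _+_
  (sumFrom1-zero N λ i 1≤i i≤N → others i 1≤i (m≤n⇒m≤1+n i≤N) (<⇒≢ (s≤s i≤N)))
  gi₀≡1
... | no i₀≢1+N = cong₂ _+_
  (sumFrom1-single N i₀ 1≤i₀ (≤-pred (≤∧≢⇒< i₀≤1+N i₀≢1+N)) gi₀≡1
     λ i 1≤i i≤N → others i 1≤i (m≤n⇒m≤1+n i≤N))
  (others (suc N) (s≤s z≤n) ≤-refl (i₀≢1+N ∘ sym))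

Letter : ℕ → ℕ → Set
Letter s x = 1 ≤ x × x ≤ s

sum-applyUpTo : ∀ s (g : ℕ → ℕ) → sum (applyUpTo g s) ≡ sumBelow s g
sum-applyUpTo zero g = refl
sum-applyUpTo (suc s) g = cong (g 0 +_) (sum-applyUpTo s (g ∘ suc))

sumWords : ℕ → ℕ → (List ℕ → ℕ) → ℕ
sumWords zero s f = f []
sumWords (suc n) s f = sumBelow s (λ x → sumWords n s (λ w → f (suc x ∷ w)))

sumWords-cong : ∀ n s {f g : List ℕ → ℕ} →
                (∀ w → length w ≡ n → All (Letter s) w → f w ≡ g w) → sumWords n s f ≡ sumWords n s g
sumWords-cong zero s f≡g = f≡g [] refl []
sumWords-cong (suc n) s f≡g = sumBelow-cong s λ x x<s →
  sumWords-cong n s λ w |w|≡n w∈s → f≡g (suc x ∷ w) (cong suc |w|≡n) ((s≤s z≤n , x<s) ∷ w∈s)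

sumWords-zero : ∀ n s → sumWords n s (λ _ → 0) ≡ 0
sumWords-zero zero s = refl
sumWords-zero (suc n) s = trans (sumBelow-cong s λ _ _ → sumWords-zero n s) (sumBelow-zero s)

sumWords-+ : ∀ n s (f g : List ℕ → ℕ) → sumWords n s (λ w → f w + g w) ≡ sumWords n s f + sumWords n s g
sumWords-+ zero s f g = refl
sumWords-+ (suc n) s f g = trans (sumBelow-cong s λ _ _ → sumWords-+ n s _ _) (sumBelow-+ s _ _)

sumWords-sumFrom1 : ∀ N n s (F : ℕ → List ℕ → ℕ) →
                    sumWords n s (λ w → sumFrom1 N (λ i → F i w)) ≡ sumFrom1 N (λ i → sumWords n s (F i))
sumWords-sumFrom1 zero n s F = sumWords-zero n s
sumWords-sumFrom1 (suc N) n s F =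
  trans (sumWords-+ n s _ _) (cong (_+ sumWords n s (F (suc N))) (sumWords-sumFrom1 N n s F))

module _ {p} {P : Pred (List ℕ) p} (P? : Decidable P) where

  length-filter-∷ : ∀ w ws → length (filter P? (w ∷ ws)) ≡ indicator (P? w) + length (filter P? ws)
  length-filter-∷ w ws with P? w
  ... | yes _ = refl
  ... | no _ = refl

  length-filter-concatMap : ∀ (f : ℕ → List (List ℕ)) xs →
                            length (filter P? (concatMap f xs)) ≡ sum (map (λ x → length (filter P? (f x))) xs)
  length-filter-concatMap f [] = refl
  length-filter-concatMap f (x ∷ xs) = begin
    length (filter P? (f x ++ concatMap f xs))               ≡⟨ cong length (filter-++ P? (f x) _) ⟩
    length (filter P? (f x) ++ filter P? (concatMap f xs))    ≡⟨ length-++ (filter P? (f x)) ⟩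
    length (filter P? (f x)) + length (filter P? (concatMap f xs))
      ≡⟨ cong (length (filter P? (f x)) +_) (length-filter-concatMap f xs) ⟩
    _ ∎
    where open ≡-Reasoning

length-filter-map-∷ : ∀ {p} {P : Pred (List ℕ) p} (P? : Decidable P) x ws →
                      length (filter P? (map (x ∷_) ws)) ≡ length (filter (P? ∘ (x ∷_)) ws)
length-filter-map-∷ P? x [] = refl
length-filter-map-∷ P? x (w ∷ ws) = begin
  length (filter P? ((x ∷ w) ∷ map (x ∷_) ws))           ≡⟨ length-filter-∷ P? (x ∷ w) _ ⟩
  indicator (P? (x ∷ w)) + length (filter P? (map (x ∷_) ws)) ≡⟨ cong (_ +_) (length-filter-map-∷ P? x ws) ⟩
  indicator (P? (x ∷ w)) + length (filter (P? ∘ (x ∷_)) ws) ≡⟨ length-filter-∷ (P? ∘ (x ∷_)) w ws ⟨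
  length (filter (P? ∘ (x ∷_)) (w ∷ ws)) ∎
  where open ≡-Reasoning

length-filter-seqs : ∀ {p} {P : Pred (List ℕ) p} n s (P? : Decidable P) →
                     length (filter P? (seqs n s)) ≡ sumWords n s (indicator ∘ P?)
length-filter-seqs zero s P? = trans (length-filter-∷ P? [] []) (+-identityʳ _)
length-filter-seqs (suc n) s P? = begin
  length (filter P? (concatMap (λ a → map (a ∷_) (seqs n s)) (map suc (upTo s))))
    ≡⟨ length-filter-concatMap P? _ (map suc (upTo s)) ⟩
  sum (map count (map suc (upTo s)))
    ≡⟨ cong sum (trans (cong (map count) (map-upTo suc s)) (map-applyUpTo suc count s)) ⟩
  sum (applyUpTo (count ∘ suc) s)
    ≡⟨ sum-applyUpTo s (count ∘ suc) ⟩
  sumBelow s (count ∘ suc)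
    ≡⟨ sumBelow-cong s (λ x _ → trans (length-filter-map-∷ P? (suc x) (seqs n s))
                                      (length-filter-seqs n s (P? ∘ (suc x ∷_)))) ⟩
  sumWords (suc n) s (indicator ∘ P?) ∎
  where
  open ≡-Reasoning
  count : ℕ → ℕ
  count a = length (filter P? (map (a ∷_) (seqs n s)))

-- Splitting a word at a letter

below : ℕ → List ℕ → List ℕ
below e = filter (_<? e)

above : ℕ → List ℕ → List ℕ
above e w = map (_∸ e) (filter (e <?_) w)

Avoids : ℕ → List ℕ → Set
Avoids e = All (_≢ e)

avoids? : ∀ e → Decidable (Avoids e)
avoids? e = all? (λ x → ¬? (x ≟ e))

splitWeight : ℕ → (List ℕ → ℕ) → (List ℕ → ℕ) → ℕ → List ℕ → ℕ
splitWeight e f g j w =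
  indicator (avoids? e w) * f (below e w) * g (above e w) * indicator (length (above e w) ≟ j)

module _ {e x : ℕ} {w : List ℕ} where

  avoids?-∷ : x ≢ e → indicator (avoids? e (x ∷ w)) ≡ indicator (avoids? e w)
  avoids?-∷ x≢e with x ≟ e | avoids? e w
  ... | yes x≡e | _ = contradiction x≡e x≢e
  ... | no _ | yes _ = refl
  ... | no _ | no _ = refl

  below-< : x < e → below e (x ∷ w) ≡ x ∷ below e w
  below-< = filter-accept (_<? e)

  below-≮ : ¬ x < e → below e (x ∷ w) ≡ below e w
  below-≮ = filter-reject (_<? e)

  above-> : e < x → above e (x ∷ w) ≡ x ∸ e ∷ above e w
  above-> e<x = cong (map (_∸ e)) (filter-accept (e <?_) e<x)

  above-≯ : ¬ e < x → above e (x ∷ w) ≡ above e w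
  above-≯ e≮x = cong (map (_∸ e)) (filter-reject (e <?_) e≮x)

indicator-suc-≟ : ∀ m n → indicator (suc m ≟ suc n) ≡ indicator (m ≟ n)
indicator-suc-≟ m n with m ≟ n
... | yes refl = indicator-yes (suc m ≟ suc m) refl
... | no m≢n = indicator-no (suc m ≟ suc n) (m≢n ∘ suc-injective)

module _ (f g : List ℕ → ℕ) {e x : ℕ} where

  splitWeight-< : ∀ j w → x < e → splitWeight e f g j (x ∷ w) ≡ splitWeight e (f ∘ (x ∷_)) g j w
  splitWeight-< j w x<e
    rewrite avoids?-∷ {w = w} (<⇒≢ x<e) | below-< {w = w} x<e | above-≯ {w = w} (<⇒≯ x<e) = refl

  splitWeight-> : ∀ j w → e < x → splitWeight e f g (suc j) (x ∷ w) ≡ splitWeight e f (g ∘ (x ∸ e ∷_)) j w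
  splitWeight-> j w e<x
    rewrite avoids?-∷ {w = w} (>⇒≢ e<x) | below-≮ {w = w} (<⇒≱ e<x ∘ <⇒≤) | above-> {w = w} e<x
    = cong (indicator (avoids? e w) * f (below e w) * g (x ∸ e ∷ above e w) *_)
           (indicator-suc-≟ (length (above e w)) j)

  splitWeight->-0 : ∀ w → e < x → splitWeight e f g 0 (x ∷ w) ≡ 0
  splitWeight->-0 w e<x
    rewrite avoids?-∷ {w = w} (>⇒≢ e<x) | below-≮ {w = w} (<⇒≱ e<x ∘ <⇒≤) | above-> {w = w} e<x
    = trans (cong (indicator (avoids? e w) * f (below e w) * g (x ∸ e ∷ above e w) *_)
                  (indicator-no (suc (length (above e w)) ≟ 0) λ ()))
            (*-zeroʳ (indicator (avoids? e w) * f (below e w) * g (x ∸ e ∷ above e w)))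

splitWeight-≡ : ∀ e f g j w → splitWeight e f g j (e ∷ w) ≡ 0
splitWeight-≡ e f g j w with e ≟ e
... | yes _ = refl
... | no e≢e = contradiction refl e≢e

C-*-suc-∸ : ∀ m j (h : ℕ → ℕ) → (m C j) * h (suc (m ∸ j)) ≡ (m C j) * h (suc m ∸ j)
C-*-suc-∸ m j h with j ≤? m
... | yes j≤m = cong (λ i → (m C j) * h i) (sym (+-∸-assoc 1 j≤m))
... | no j≰m rewrite k>n⇒nCk≡0 (≰⇒> j≰m) = refl

pascal-* : ∀ m j a b → (m C suc j) * a * b + (m C j) * a * b ≡ (suc m C suc j) * a * b
pascal-* m j a b = begin
  (m C suc j) * a * b + (m C j) * a * b   ≡⟨ *-distribʳ-+ b ((m C suc j) * a) _ ⟨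
  ((m C suc j) * a + (m C j) * a) * b     ≡⟨ cong (_* b) (*-distribʳ-+ a (m C suc j) _) ⟨
  ((m C suc j) + (m C j)) * a * b         ≡⟨ cong (λ c → c * a * b) (+-comm (m C suc j) _) ⟩
  ((m C j) + (m C suc j)) * a * b         ≡⟨ cong (λ c → c * a * b) (nCk+nC[k+1]≡[n+1]C[k+1] m j) ⟩
  (suc m C suc j) * a * b                 ∎
  where open ≡-Reasoning

-- A word avoiding e is determined by the positions of its j letters above e and by its two
-- subwords, whence the binomial coefficient.
sumWords-splitWeight : ∀ d t m j (f g : List ℕ → ℕ) →
  sumWords m (suc (d + t)) (splitWeight (suc d) f g j) ≡ (m C j) * sumWords (m ∸ j) d f * sumWords j t g
sumWords-splitWeight d t zero zero f g = *-identityʳ (1 * f [] * g [])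
sumWords-splitWeight d t zero (suc j) f g = *-zeroʳ (1 * f [] * g [])
sumWords-splitWeight d t (suc m) j f g = begin
  sumBelow (suc (d + t)) G                                ≡⟨ cong (λ s → sumBelow s G) (+-suc d t) ⟨
  sumBelow (d + suc t) G                                  ≡⟨ sumBelow-split d (suc t) G ⟩
  sumBelow d G + (G (d + 0) + Above j)                    ≡⟨ cong₂ _+_ lettersBelow (cong (_+ Above j) letterAt) ⟩
  (m C j) * sumWords (suc m ∸ j) d f * sumWords j t g + Above j  ≡⟨ lettersAbove j ⟩
  (suc m C j) * sumWords (suc m ∸ j) d f * sumWords j t g ∎
  where
  open ≡-Reasoning
  s = suc (d + t)
  G : ℕ → ℕ
  G x = sumWords m s (λ w → splitWeight (suc d) f g j (suc x ∷ w))
  Above : ℕ → ℕ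
  Above i = sumBelow t (λ y → sumWords m s (λ w → splitWeight (suc d) f g i (suc (d + suc y) ∷ w)))

  lettersBelow : sumBelow d G ≡ (m C j) * sumWords (suc m ∸ j) d f * sumWords j t g
  lettersBelow = begin
    sumBelow d G
      ≡⟨ sumBelow-cong d (λ x x<d → sumWords-cong m s λ w _ _ → splitWeight-< f g j w (s<s x<d)) ⟩
    sumBelow d (λ x → sumWords m s (splitWeight (suc d) (f ∘ (suc x ∷_)) g j))
      ≡⟨ sumBelow-cong d (λ x _ → sumWords-splitWeight d t m j (f ∘ (suc x ∷_)) g) ⟩
    sumBelow d (λ x → (m C j) * sumWords (m ∸ j) d (f ∘ (suc x ∷_)) * Y)
      ≡⟨ sumBelow-cong d (λ x _ → *-assoc (m C j) _ Y) ⟩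
    sumBelow d (λ x → (m C j) * (sumWords (m ∸ j) d (f ∘ (suc x ∷_)) * Y))
      ≡⟨ sumBelow-*ˡ d (m C j) _ ⟩
    (m C j) * sumBelow d (λ x → sumWords (m ∸ j) d (f ∘ (suc x ∷_)) * Y)
      ≡⟨ cong ((m C j) *_) (sumBelow-*ʳ d Y _) ⟩
    (m C j) * (sumWords (suc (m ∸ j)) d f * Y)
      ≡⟨ *-assoc (m C j) _ Y ⟨
    (m C j) * sumWords (suc (m ∸ j)) d f * Y
      ≡⟨ cong (_* Y) (C-*-suc-∸ m j (λ i → sumWords i d f)) ⟩
    (m C j) * sumWords (suc m ∸ j) d f * Y ∎
    where Y = sumWords j t g

  letterAt : G (d + 0) ≡ 0
  letterAt = trans (sumWords-cong m s λ w _ _ → trans (cong (λ x → splitWeight (suc d) f g j (suc x ∷ w)) (+-identityʳ d))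
                                                       (splitWeight-≡ (suc d) f g j w))
                   (sumWords-zero m s)

  gap<letter : ∀ y → suc d < suc (d + suc y)
  gap<letter y = s≤s (m<m+n d z<s)

  Above-0 : Above 0 ≡ 0
  Above-0 = trans (sumBelow-cong t λ y _ → trans (sumWords-cong m s λ w _ _ → splitWeight->-0 f g w (gap<letter y))
                                                 (sumWords-zero m s))
                  (sumBelow-zero t)

  Above-suc : ∀ j → Above (suc j) ≡ (m C j) * sumWords (m ∸ j) d f * sumWords (suc j) t g
  Above-suc j = begin
    Above (suc j)
      ≡⟨ sumBelow-cong t (λ y _ → sumWords-cong m s λ w _ _ →
           trans (splitWeight-> f g j w (gap<letter y))
                 (cong (λ z → splitWeight (suc d) f (g ∘ (z ∷_)) j w) (m+n∸m≡n (suc d) (suc y)))) ⟩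
    sumBelow t (λ y → sumWords m s (splitWeight (suc d) f (g ∘ (suc y ∷_)) j))
      ≡⟨ sumBelow-cong t (λ y _ → sumWords-splitWeight d t m j f (g ∘ (suc y ∷_))) ⟩
    sumBelow t (λ y → (m C j) * sumWords (m ∸ j) d f * sumWords j t (g ∘ (suc y ∷_)))
      ≡⟨ sumBelow-*ˡ t ((m C j) * sumWords (m ∸ j) d f) _ ⟩
    (m C j) * sumWords (m ∸ j) d f * sumWords (suc j) t g ∎

  lettersAbove : ∀ j → (m C j) * sumWords (suc m ∸ j) d f * sumWords j t g + Above j
                     ≡ (suc m C j) * sumWords (suc m ∸ j) d f * sumWords j t g
  lettersAbove zero = trans (cong (1 * sumWords (suc m) d f * g [] +_) Above-0) (+-identityʳ _)
  lettersAbove (suc j) = trans (cong ((m C suc j) * A * sumWords (suc j) t g +_) (Above-suc j)) (pascal-* m j A _)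
    where A = sumWords (m ∸ j) d f

length-below+above : ∀ e w → Avoids e w → length (below e w) + length (above e w) ≡ length w
length-below+above e [] _ = refl
length-below+above e (x ∷ w) (x≢e ∷ avoids) with <-cmp x e
... | tri< x<e _ _ rewrite below-< {w = w} x<e | above-≯ {w = w} (<⇒≯ x<e) =
  cong suc (length-below+above e w avoids)
... | tri≈ _ x≡e _ = contradiction x≡e x≢e
... | tri> _ _ e<x rewrite below-≮ {w = w} (<⇒≯ e<x) | above-> {w = w} e<x =
  trans (+-suc (length (below e w)) _) (cong suc (length-below+above e w avoids))

above-≤ : ∀ e w → All (_≤ e) w → above e w ≡ []
above-≤ e [] _ = refl
above-≤ e (x ∷ w) (x≤e ∷ w≤e) = trans (above-≯ {w = w} (≤⇒≯ x≤e)) (above-≤ e w w≤e)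

-- Parking

park : ℕ → List Bool → List Bool
park d st = proj₁ (parkFrom d st)

parks : ℕ → List Bool → Bool
parks d st = proj₂ (parkFrom d st)

parkFrom-0-true : ∀ st → parkFrom 0 (true ∷ st) ≡ (true ∷ park 0 st , parks 0 st)
parkFrom-0-true st with parkFrom 0 st
... | _ , _ = refl

parkFrom-suc : ∀ d o st → parkFrom (suc d) (o ∷ st) ≡ (o ∷ park d st , parks d st)
parkFrom-suc d o st with parkFrom d st
... | _ , _ = refl

failure : Bool → ℕ
failure true = 0
failure false = 1

failures : List Bool → List ℕ → ℕ
failures st [] = 0
failures st (a ∷ as) = failure (parks (a ∸ 1) st) + failures (park (a ∸ 1) st) as

finalState : List Bool → List ℕ → List Bool
finalState st [] = st
finalState st (a ∷ as) = finalState (park (a ∸ 1) st) as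

failsFrom≡failures : ∀ st as → failsFrom st as ≡ failures st as
failsFrom≡failures st [] = refl
failsFrom≡failures st (a ∷ as) with parkFrom (a ∸ 1) st
... | st′ , true = failsFrom≡failures st′ as
... | st′ , false = cong suc (failsFrom≡failures st′ as)

emptyLot : ℕ → List Bool
emptyLot m = replicate m false

flaws≡failures : ∀ m as → flaws m as ≡ failures (emptyLot m) as
flaws≡failures m = failsFrom≡failures (emptyLot m)

length-park : ∀ d st → length (park d st) ≡ length st
length-park d [] = refl
length-park zero (false ∷ st) = refl
length-park zero (true ∷ st) rewrite parkFrom-0-true st = cong suc (length-park 0 st)
length-park (suc d) (o ∷ st) rewrite parkFrom-suc d o st = cong suc (length-park d st)

length-finalState : ∀ st as → length (finalState st as) ≡ length st
length-finalState st [] = refl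
length-finalState st (a ∷ as) = trans (length-finalState _ as) (length-park (a ∸ 1) st)

park-fail : ∀ d st → parks d st ≡ false → park d st ≡ st
park-fail d [] _ = refl
park-fail zero (true ∷ st) fails rewrite parkFrom-0-true st = cong (true ∷_) (park-fail 0 st fails)
park-fail (suc d) (o ∷ st) fails rewrite parkFrom-suc d o st = cong (o ∷_) (park-fail d st fails)

parks-beyond : ∀ d st → length st ≤ d → parks d st ≡ false
parks-beyond d [] _ = refl
parks-beyond (suc d) (o ∷ st) (s≤s |st|≤d) rewrite parkFrom-suc d o st = parks-beyond d st |st|≤d

park-++-success : ∀ d l r → parks d l ≡ true → park d (l ++ r) ≡ park d l ++ r × parks d (l ++ r) ≡ true
park-++-success zero (false ∷ l) r _ = refl , refl
park-++-success zero (true ∷ l) r parked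
  rewrite parkFrom-0-true (l ++ r) | parkFrom-0-true l with park-++-success 0 l r parked
... | park≡ , parks≡ = cong (true ∷_) park≡ , parks≡
park-++-success (suc d) (o ∷ l) r parked
  rewrite parkFrom-suc d o (l ++ r) | parkFrom-suc d o l with park-++-success d l r parked
... | park≡ , parks≡ = cong (o ∷_) park≡ , parks≡

park-++-fail : ∀ d l r → parks d l ≡ false →
               park d (l ++ r) ≡ l ++ park (d ∸ length l) r × parks d (l ++ r) ≡ parks (d ∸ length l) r
park-++-fail d [] r _ = refl , refl
park-++-fail zero (true ∷ l) r fails
  rewrite parkFrom-0-true (l ++ r) | parkFrom-0-true l with park-++-fail 0 l r fails
... | park≡ , parks≡ rewrite 0∸n≡0 (length l) = cong (true ∷_) park≡ , parks≡
park-++-fail (suc d) (o ∷ l) r fails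
  rewrite parkFrom-suc d o (l ++ r) | parkFrom-suc d o l with park-++-fail d l r fails
... | park≡ , parks≡ = cong (o ∷_) park≡ , parks≡

occupancy : List Bool → ℕ
occupancy [] = 0
occupancy (true ∷ st) = suc (occupancy st)
occupancy (false ∷ st) = occupancy st

occupancy≤length : ∀ st → occupancy st ≤ length st
occupancy≤length [] = z≤n
occupancy≤length (true ∷ st) = s≤s (occupancy≤length st)
occupancy≤length (false ∷ st) = m≤n⇒m≤1+n (occupancy≤length st)

occupancy-emptyLot : ∀ m → occupancy (emptyLot m) ≡ 0
occupancy-emptyLot zero = refl
occupancy-emptyLot (suc m) = occupancy-emptyLot m

occupancy-replicate-true : ∀ m → occupancy (replicate m true) ≡ m
occupancy-replicate-true zero = refl
occupancy-replicate-true (suc m) = cong suc (occupancy-replicate-true m)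

full⇒replicate-true : ∀ st → occupancy st ≡ length st → st ≡ replicate (length st) true
full⇒replicate-true [] _ = refl
full⇒replicate-true (true ∷ st) full = cong (true ∷_) (full⇒replicate-true st (suc-injective full))
full⇒replicate-true (false ∷ st) full = contradiction (occupancy≤length st) (<⇒≱ (≤-reflexive (sym full)))

occupancy-park : ∀ d st → failure (parks d st) + occupancy (park d st) ≡ suc (occupancy st)
occupancy-park d [] = refl
occupancy-park zero (false ∷ st) = refl
occupancy-park zero (true ∷ st) rewrite parkFrom-0-true st =
  trans (+-suc (failure (parks 0 st)) _) (cong suc (occupancy-park 0 st))
occupancy-park (suc d) (true ∷ st) rewrite parkFrom-suc d true st =
  trans (+-suc (failure (parks d st)) _) (cong suc (occupancy-park d st))
occupancy-park (suc d) (false ∷ st) rewrite parkFrom-suc d false st = occupancy-park d st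

failures+occupancy : ∀ st as → failures st as + occupancy (finalState st as) ≡ length as + occupancy st
failures+occupancy st [] = refl
failures+occupancy st (a ∷ as) = begin
  (failure p + failures st′ as) + occupancy (finalState st′ as)  ≡⟨ +-assoc (failure p) _ _ ⟩
  failure p + (failures st′ as + occupancy (finalState st′ as))  ≡⟨ cong (failure p +_) (failures+occupancy st′ as) ⟩
  failure p + (length as + occupancy st′)                        ≡⟨ +-comm (failure p) _ ⟩
  (length as + occupancy st′) + failure p                        ≡⟨ +-assoc (length as) _ _ ⟩
  length as + (occupancy st′ + failure p)                        ≡⟨ cong (length as +_) (+-comm _ (failure p)) ⟩
  length as + (failure p + occupancy st′)                        ≡⟨ cong (length as +_) (occupancy-park (a ∸ 1) st) ⟩
  length as + suc (occupancy st)                                 ≡⟨ +-suc (length as) _ ⟩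
  suc (length as + occupancy st)                                 ∎
  where
  open ≡-Reasoning
  p = parks (a ∸ 1) st
  st′ = park (a ∸ 1) st

failures+occupancy-emptyLot : ∀ m w → failures (emptyLot m) w + occupancy (finalState (emptyLot m) w) ≡ length w
failures+occupancy-emptyLot m w = begin
  failures (emptyLot m) w + occupancy (finalState (emptyLot m) w)  ≡⟨ failures+occupancy (emptyLot m) w ⟩
  length w + occupancy (emptyLot m)                                ≡⟨ cong (length w +_) (occupancy-emptyLot m) ⟩
  length w + 0                                                     ≡⟨ +-identityʳ (length w) ⟩
  length w                                                         ∎
  where open ≡-Reasoning

length-finalState-emptyLot : ∀ m w → length (finalState (emptyLot m) w) ≡ m
length-finalState-emptyLot m w = trans (length-finalState (emptyLot m) w) (length-replicate m)

finalState-full : ∀ m w → failures (emptyLot m) w + m ≡ length w → finalState (emptyLot m) w ≡ replicate m true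
finalState-full m w F+m≡|w| = trans (full⇒replicate-true final occupancy≡length)
                                    (cong (λ i → replicate i true) (length-finalState-emptyLot m w))
  where
  final = finalState (emptyLot m) w
  occupancy≡length : occupancy final ≡ length final
  occupancy≡length = trans (+-cancelˡ-≡ (failures (emptyLot m) w) _ _
                              (trans (failures+occupancy-emptyLot m w) (sym F+m≡|w|)))
                           (sym (length-finalState-emptyLot m w))

finalState-full⇒length : ∀ m w → finalState (emptyLot m) w ≡ replicate m true → length w ≡ failures (emptyLot m) w + m
finalState-full⇒length m w full = begin
  length w                                                         ≡⟨ failures+occupancy-emptyLot m w ⟨
  failures (emptyLot m) w + occupancy (finalState (emptyLot m) w)  ≡⟨ cong (λ st → failures (emptyLot m) w + occupancy st) full ⟩
  failures (emptyLot m) w + occupancy (replicate m true)           ≡⟨ cong (failures (emptyLot m) w +_) (occupancy-replicate-true m) ⟩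
  failures (emptyLot m) w + m                                      ∎
  where open ≡-Reasoning

occupied : List Bool → ℕ → Bool
occupied [] _ = false
occupied (o ∷ st) zero = o
occupied (o ∷ st) (suc p) = occupied st p

occupied-park : ∀ d st p → occupied st p ≡ true → occupied (park d st) p ≡ true
occupied-park zero (true ∷ st) zero _ rewrite parkFrom-0-true st = refl
occupied-park zero (true ∷ st) (suc p) occ rewrite parkFrom-0-true st = occupied-park 0 st p occ
occupied-park zero (false ∷ st) (suc p) occ = occ
occupied-park (suc d) (o ∷ st) zero occ rewrite parkFrom-suc d o st = occ
occupied-park (suc d) (o ∷ st) (suc p) occ rewrite parkFrom-suc d o st = occupied-park d st p occ

occupied-finalState : ∀ st as p → occupied st p ≡ true → occupied (finalState st as) p ≡ true
occupied-finalState st [] p occ = occ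
occupied-finalState st (a ∷ as) p occ = occupied-finalState _ as p (occupied-park (a ∸ 1) st p occ)

occupied-++ : ∀ l o r → occupied (l ++ o ∷ r) (length l) ≡ o
occupied-++ [] o r = refl
occupied-++ (_ ∷ l) o r = occupied-++ l o r

-- Parking around an empty space

module _ {d : ℕ} (l r : List Bool) (|l|≡d : length l ≡ d) where

  park-into-gap : ∀ {x} → x ≤ suc d → parks (x ∸ 1) l ≡ false →
                  park (x ∸ 1) (l ++ false ∷ r) ≡ l ++ true ∷ r
  park-into-gap {x} x≤1+d fails = begin
    park (x ∸ 1) (l ++ false ∷ r)             ≡⟨ proj₁ (park-++-fail (x ∸ 1) l (false ∷ r) fails) ⟩
    l ++ park (x ∸ 1 ∸ length l) (false ∷ r)  ≡⟨ cong (λ i → l ++ park i (false ∷ r)) (m≤n⇒m∸n≡0 x∸1≤|l|) ⟩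
    l ++ true ∷ r                             ∎
    where
    open ≡-Reasoning
    x∸1≤|l| : x ∸ 1 ≤ length l
    x∸1≤|l| = subst (x ∸ 1 ≤_) (sym |l|≡d) (∸-monoˡ-≤ 1 x≤1+d)

  park-past-gap : ∀ {x} → suc d < x →
                  park (x ∸ 1) (l ++ false ∷ r) ≡ l ++ false ∷ park (x ∸ suc d ∸ 1) r ×
                  parks (x ∸ 1) (l ++ false ∷ r) ≡ parks (x ∸ suc d ∸ 1) r
  park-past-gap {x} 1+d<x = park≡ , parks≡
    where
    open ≡-Reasoning
    y = x ∸ suc d ∸ 1
    fails : parks (x ∸ 1) l ≡ false
    fails = parks-beyond (x ∸ 1) l (subst (_≤ x ∸ 1) (sym |l|≡d) (∸-monoˡ-≤ 1 (<⇒≤ 1+d<x)))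
    offset : x ∸ 1 ∸ length l ≡ suc y
    offset = begin
      x ∸ 1 ∸ length l      ≡⟨ cong (x ∸ 1 ∸_) |l|≡d ⟩
      x ∸ 1 ∸ d             ≡⟨ ∸-+-assoc x 1 d ⟩
      x ∸ suc d             ≡⟨ m+[n∸m]≡n (m<n⇒0<n∸m 1+d<x) ⟨
      suc y                 ∎
    park≡ : park (x ∸ 1) (l ++ false ∷ r) ≡ l ++ false ∷ park y r
    park≡ = begin
      park (x ∸ 1) (l ++ false ∷ r)             ≡⟨ proj₁ (park-++-fail (x ∸ 1) l (false ∷ r) fails) ⟩
      l ++ park (x ∸ 1 ∸ length l) (false ∷ r)  ≡⟨ cong (λ i → l ++ park i (false ∷ r)) offset ⟩
      l ++ park (suc y) (false ∷ r)             ≡⟨ cong (λ p → l ++ proj₁ p) (parkFrom-suc y false r) ⟩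
      l ++ false ∷ park y r                     ∎
    parks≡ : parks (x ∸ 1) (l ++ false ∷ r) ≡ parks y r
    parks≡ = begin
      parks (x ∸ 1) (l ++ false ∷ r)            ≡⟨ proj₂ (park-++-fail (x ∸ 1) l (false ∷ r) fails) ⟩
      parks (x ∸ 1 ∸ length l) (false ∷ r)      ≡⟨ cong (λ i → parks i (false ∷ r)) offset ⟩
      parks (suc y) (false ∷ r)                 ≡⟨ cong proj₂ (parkFrom-suc y false r) ⟩
      parks y r                                 ∎

gap-decomposition : ∀ d l r a → length l ≡ d → Avoids (suc d) a → failures l (below (suc d) a) ≡ 0 →
  failures (l ++ false ∷ r) a ≡ failures r (above (suc d) a) ×
  finalState (l ++ false ∷ r) a ≡ finalState l (below (suc d) a) ++ false ∷ finalState r (above (suc d) a)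
gap-decomposition d l r [] _ _ _ = refl , refl
gap-decomposition d l r (x ∷ a) |l|≡d (x≢1+d ∷ avoids) noFailure with <-cmp x (suc d)
... | tri≈ _ x≡1+d _ = contradiction x≡1+d x≢1+d
... | tri< x<1+d _ _ rewrite below-< {w = a} x<1+d | above-≯ {w = a} (<⇒≯ x<1+d) with parks (x ∸ 1) l in parked
...   | true rewrite proj₁ (park-++-success (x ∸ 1) l (false ∷ r) parked)
                   | proj₂ (park-++-success (x ∸ 1) l (false ∷ r) parked) =
  gap-decomposition d (park (x ∸ 1) l) r a (trans (length-park (x ∸ 1) l) |l|≡d) avoids noFailure
gap-decomposition d l r (x ∷ a) |l|≡d (x≢1+d ∷ avoids) () | tri< _ _ _ | false
gap-decomposition d l r (x ∷ a) |l|≡d (x≢1+d ∷ avoids) noFailure | tri> _ _ 1+d<x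
  rewrite below-≮ {w = a} (<⇒≯ 1+d<x) | above-> {w = a} 1+d<x
        | proj₁ (park-past-gap l r |l|≡d 1+d<x) | proj₂ (park-past-gap l r |l|≡d 1+d<x)
  with gap-decomposition d l (park (x ∸ suc d ∸ 1) r) a |l|≡d avoids noFailure
... | failures≡ , finalState≡ = cong (failure (parks (x ∸ suc d ∸ 1) r) +_) failures≡ , finalState≡

StaysEmpty : ℕ → List ℕ → List Bool → Set
StaysEmpty d a st = occupied (finalState st a) d ≡ false

filled-gap-not-empty : ∀ {d l r} a → length l ≡ d → ¬ StaysEmpty d a (l ++ true ∷ r)
filled-gap-not-empty {l = l} {r} a refl empty with
  trans (sym (occupied-finalState (l ++ true ∷ r) a (length l) (occupied-++ l true r))) empty
... | ()

gap-staysEmpty⇒ : ∀ d l r a → length l ≡ d → StaysEmpty d a (l ++ false ∷ r) →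
             Avoids (suc d) a × failures l (below (suc d) a) ≡ 0
gap-staysEmpty⇒ d l r [] _ _ = [] , refl
gap-staysEmpty⇒ d l r (x ∷ a) |l|≡d empty with <-cmp x (suc d)
... | tri< x<1+d _ _ rewrite below-< {w = a} x<1+d with parks (x ∸ 1) l in parked
...   | true with gap-staysEmpty⇒ d (park (x ∸ 1) l) r a (trans (length-park (x ∸ 1) l) |l|≡d)
                   (subst (StaysEmpty d a) (proj₁ (park-++-success (x ∸ 1) l (false ∷ r) parked)) empty)
...     | avoids , noFailure = <⇒≢ x<1+d ∷ avoids , noFailure
gap-staysEmpty⇒ d l r (x ∷ a) |l|≡d empty | tri< x<1+d _ _ | false =
  ⊥-elim (filled-gap-not-empty a |l|≡d (subst (StaysEmpty d a) (park-into-gap l r |l|≡d (<⇒≤ x<1+d) parked) empty))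
gap-staysEmpty⇒ d l r (x ∷ a) |l|≡d empty | tri≈ _ refl _ =
  ⊥-elim (filled-gap-not-empty a |l|≡d (subst (StaysEmpty d a) (park-into-gap l r |l|≡d ≤-refl fails) empty))
  where
  fails : parks d l ≡ false
  fails = parks-beyond d l (≤-reflexive |l|≡d)
gap-staysEmpty⇒ d l r (x ∷ a) |l|≡d empty | tri> _ _ 1+d<x
  rewrite below-≮ {w = a} (<⇒≯ 1+d<x)
  with gap-staysEmpty⇒ d l (park (x ∸ suc d ∸ 1) r) a |l|≡d
         (subst (StaysEmpty d a) (proj₁ (park-past-gap l r |l|≡d 1+d<x)) empty)
... | avoids , noFailure = >⇒≢ 1+d<x ∷ avoids , noFailure

-- When every preference lies in st, each car failing there enters ext at its first space.
failures-++ : ∀ st ext w → All (_≤ length st) w →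
              failures (st ++ ext) w ≡ failures ext (replicate (failures st w) 1)
failures-++ st ext [] _ = refl
failures-++ st ext (x ∷ w) (x≤|st| ∷ w≤|st|) with parks (x ∸ 1) st in parked
... | true
  rewrite proj₁ (park-++-success (x ∸ 1) st ext parked)
        | proj₂ (park-++-success (x ∸ 1) st ext parked)
  = failures-++ (park (x ∸ 1) st) ext w (subst (λ m → All (_≤ m) w) (sym (length-park (x ∸ 1) st)) w≤|st|)
... | false
  rewrite proj₁ (park-++-fail (x ∸ 1) st ext parked)
        | proj₂ (park-++-fail (x ∸ 1) st ext parked)
        | park-fail (x ∸ 1) st parked
        | m≤n⇒m∸n≡0 (≤-trans (m∸n≤m x 1) x≤|st|)
  = cong (failure (parks 0 ext) +_) (failures-++ st (park 0 ext) w w≤|st|)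

parkFrom-0-full : ∀ t st → parkFrom 0 (replicate t true ++ st) ≡ (replicate t true ++ park 0 st , parks 0 st)
parkFrom-0-full zero st = refl
parkFrom-0-full (suc t) st rewrite parkFrom-0-true (replicate t true ++ st) | parkFrom-0-full t st = refl

replicate-++-∷ : ∀ {A : Set} t (x : A) xs → replicate t x ++ x ∷ xs ≡ x ∷ replicate t x ++ xs
replicate-++-∷ zero x xs = refl
replicate-++-∷ (suc t) x xs = cong (x ∷_) (replicate-++-∷ t x xs)

failures-ones : ∀ t j F → failures (replicate t true ++ emptyLot j) (replicate F 1) ≡ F ∸ j
failures-ones t j zero = sym (0∸n≡0 j)
failures-ones t zero (suc F) rewrite parkFrom-0-full t [] = cong suc (failures-ones t 0 F)
failures-ones t (suc j) (suc F)
  rewrite parkFrom-0-full t (false ∷ emptyLot j) | replicate-++-∷ t true (emptyLot j)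
  = failures-ones (suc t) j F

emptyLot-+ : ∀ m k → emptyLot (m + k) ≡ emptyLot m ++ emptyLot k
emptyLot-+ zero k = refl
emptyLot-+ (suc m) k = cong (false ∷_) (emptyLot-+ m k)

flaws-+ : ∀ m k w → All (_≤ m) w → flaws (m + k) w ≡ flaws m w ∸ k
flaws-+ m k w w≤m = begin
  flaws (m + k) w                                                ≡⟨ flaws≡failures (m + k) w ⟩
  failures (emptyLot (m + k)) w                                  ≡⟨ cong (λ st → failures st w) (emptyLot-+ m k) ⟩
  failures (emptyLot m ++ emptyLot k) w                          ≡⟨ failures-++ (emptyLot m) (emptyLot k) w w≤|lot| ⟩
  failures (emptyLot k) (replicate (failures (emptyLot m) w) 1)  ≡⟨ failures-ones 0 k _ ⟩
  failures (emptyLot m) w ∸ k                                    ≡⟨ cong (_∸ k) (flaws≡failures m w) ⟨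
  flaws m w ∸ k                                                  ∎
  where
  open ≡-Reasoning
  w≤|lot| : All (_≤ length (emptyLot m)) w
  w≤|lot| = subst (λ m → All (_≤ m) w) (sym (length-replicate m)) w≤m

length≤flaws+spaces : ∀ m w → length w ≤ flaws m w + m
length≤flaws+spaces m w = begin
  length w                                                         ≡⟨ failures+occupancy-emptyLot m w ⟨
  failures (emptyLot m) w + occupancy (finalState (emptyLot m) w)  ≤⟨ +-monoʳ-≤ (failures (emptyLot m) w) final≤m ⟩
  failures (emptyLot m) w + m                                      ≡⟨ cong (_+ m) (flaws≡failures m w) ⟨
  flaws m w + m                                                    ∎
  where
  open ≤-Reasoning
  final≤m : occupancy (finalState (emptyLot m) w) ≤ m
  final≤m = ≤-trans (occupancy≤length (finalState (emptyLot m) w)) (≤-reflexive (length-finalState-emptyLot m w))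

-- m + k cars on m spaces have at least k flaws, so k extra spaces absorb all of them exactly
-- when there are k.
flaws≡k⇔parkingFunction : ∀ m k w → length w ≡ m + k → All (_≤ m) w →
                          indicator (flaws m w ≟ k) ≡ indicator (flaws (m + k) w ≟ 0)
flaws≡k⇔parkingFunction m k w |w|≡m+k w≤m with flaws m w ≟ k
... | yes refl = sym (indicator-yes (flaws (m + k) w ≟ 0) (trans (flaws-+ m k w w≤m) (n∸n≡0 k)))
... | no F≢k = sym (indicator-no (flaws (m + k) w ≟ 0) λ noFlaws →
  F≢k (≤-antisym (m∸n≡0⇒m≤n (trans (sym (flaws-+ m k w w≤m)) noFlaws)) k≤F))
  where
  k≤F : k ≤ flaws m w
  k≤F = +-cancelʳ-≤ m k (flaws m w) (subst (_≤ flaws m w + m) (trans |w|≡m+k (+-comm m k)) (length≤flaws+spaces m w))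

-- The last empty space

++-∷-cancelˡ : ∀ {A : Set} {x : A} (l₁ l₂ : List A) {r₁ r₂} → length l₁ ≡ length l₂ →
               l₁ ++ x ∷ r₁ ≡ l₂ ++ x ∷ r₂ → r₁ ≡ r₂
++-∷-cancelˡ [] [] _ eq = ∷-injectiveʳ eq
++-∷-cancelˡ (_ ∷ l₁) (_ ∷ l₂) |l₁|≡|l₂| eq = ++-∷-cancelˡ l₁ l₂ (suc-injective |l₁|≡|l₂|) (∷-injectiveʳ eq)

false∉replicate-true : ∀ m l r → replicate m true ≢ l ++ false ∷ r
false∉replicate-true (suc m) [] r ()
false∉replicate-true (suc m) (_ ∷ l) r eq = false∉replicate-true m l r (∷-injectiveʳ eq)

lastFalse-unique : ∀ l₁ l₂ {m₁ m₂} → l₁ ++ false ∷ replicate m₁ true ≡ l₂ ++ false ∷ replicate m₂ true →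
                   length l₁ ≡ length l₂
lastFalse-unique [] [] eq = refl
lastFalse-unique [] (_ ∷ l₂) eq = contradiction (∷-injectiveʳ eq) (false∉replicate-true _ l₂ _)
lastFalse-unique (_ ∷ l₁) [] eq = contradiction (sym (∷-injectiveʳ eq)) (false∉replicate-true _ l₁ _)
lastFalse-unique (_ ∷ l₁) (_ ∷ l₂) eq = cong suc (lastFalse-unique l₁ l₂ (∷-injectiveʳ eq))

lastFalse : ∀ st → occupancy st < length st → ∃[ l ] ∃[ m ] st ≡ l ++ false ∷ replicate m true
lastFalse (o ∷ st) occ< with occupancy st <? length st
... | yes occ<′ with lastFalse st occ<′
...   | l , m , st≡ = o ∷ l , m , cong (o ∷_) st≡
lastFalse (true ∷ st) occ< | no occ≮ = contradiction (≤-pred occ<) occ≮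
lastFalse (false ∷ st) occ< | no occ≮ =
  [] , length st , cong (false ∷_) (full⇒replicate-true st (≤-antisym (occupancy≤length st) (≮⇒≥ occ≮)))

emptyLot-split : ∀ {n d} → suc d ≤ n → emptyLot n ≡ emptyLot d ++ false ∷ emptyLot (n ∸ suc d)
emptyLot-split {n} {d} d<n = begin
  emptyLot n                                    ≡⟨ cong emptyLot n≡ ⟩
  emptyLot (d + suc (n ∸ suc d))                ≡⟨ emptyLot-+ d (suc (n ∸ suc d)) ⟩
  emptyLot d ++ false ∷ emptyLot (n ∸ suc d)    ∎
  where
  open ≡-Reasoning
  n≡ : n ≡ d + suc (n ∸ suc d)
  n≡ = sym (trans (+-suc d (n ∸ suc d)) (m+[n∸m]≡n d<n))

-- Summand i of the paper, for d = s − i − 1 spaces before the last empty space s − i.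
gapWeight : (n k d : ℕ) → List ℕ → ℕ
gapWeight n k d = splitWeight (suc d) (λ l → indicator (flaws d l ≟ 0))
                                      (λ r → indicator (flaws (n ∸ suc d) r ≟ k))
                                      (n ∸ suc d + k)

record SplitsAt (n k d : ℕ) (a : List ℕ) : Set where
  field
    avoids : Avoids (suc d) a
    below-parks : flaws d (below (suc d) a) ≡ 0
    above-flaws : flaws (n ∸ suc d) (above (suc d) a) ≡ k
    above-length : length (above (suc d) a) ≡ n ∸ suc d + k

*-≢0 : ∀ m n → m * n ≢ 0 → m ≢ 0 × n ≢ 0
*-≢0 m n mn≢0 = (λ { refl → mn≢0 refl }) , (λ { refl → mn≢0 (*-zeroʳ m) })

gapWeight-≢0 : ∀ n k d a → gapWeight n k d a ≢ 0 → SplitsAt n k d a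
gapWeight-≢0 n k d a w≢0 with *-≢0 _ _ w≢0
... | w₃≢0 , len≢0 with *-≢0 _ _ w₃≢0
... | w₂≢0 , above≢0 with *-≢0 _ _ w₂≢0
... | avoids≢0 , below≢0 = record
  { avoids = indicator-≢0 (avoids? (suc d) a) avoids≢0
  ; below-parks = indicator-≢0 (flaws d (below (suc d) a) ≟ 0) below≢0
  ; above-flaws = indicator-≢0 (flaws (n ∸ suc d) (above (suc d) a) ≟ k) above≢0
  ; above-length = indicator-≢0 (length (above (suc d) a) ≟ n ∸ suc d + k) len≢0
  }

gapWeight-≡1 : ∀ n k d a → SplitsAt n k d a → gapWeight n k d a ≡ 1
gapWeight-≡1 n k d a split
  rewrite indicator-yes (avoids? (suc d) a) (SplitsAt.avoids split)
        | indicator-yes (flaws d (below (suc d) a) ≟ 0) (SplitsAt.below-parks split)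
        | indicator-yes (flaws (n ∸ suc d) (above (suc d) a) ≟ k) (SplitsAt.above-flaws split)
        | indicator-yes (length (above (suc d) a) ≟ n ∸ suc d + k) (SplitsAt.above-length split) = refl

-- Position d is counted from 0, so the last empty space is space d + 1.
LastGap : ℕ → ℕ → List ℕ → Set
LastGap n d a = Σ[ l ∈ List Bool ] length l ≡ d × finalState (emptyLot n) a ≡ l ++ false ∷ replicate (n ∸ suc d) true

splitsAt⇒lastGap : ∀ n k d a → suc d ≤ n → SplitsAt n k d a → flaws n a ≡ k × LastGap n d a
splitsAt⇒lastGap n k d a d<n split = flaws≡k , finalState l (below e a) , |left|≡d , final≡
  where
  open SplitsAt split
  open ≡-Reasoning
  e = suc d
  m = n ∸ suc d
  l = emptyLot d
  r = emptyLot m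
  decomposition = gap-decomposition d l r a (length-replicate d) avoids (trans (sym (flaws≡failures d (below e a))) below-parks)
  flaws≡k : flaws n a ≡ k
  flaws≡k = begin
    flaws n a                    ≡⟨ flaws≡failures n a ⟩
    failures (emptyLot n) a      ≡⟨ cong (λ st → failures st a) (emptyLot-split d<n) ⟩
    failures (l ++ false ∷ r) a  ≡⟨ proj₁ decomposition ⟩
    failures r (above e a)       ≡⟨ flaws≡failures m (above e a) ⟨
    flaws m (above e a)          ≡⟨ above-flaws ⟩
    k                            ∎
  right-full : finalState r (above e a) ≡ replicate m true
  right-full = finalState-full m (above e a) (begin
    failures r (above e a) + m  ≡⟨ cong (_+ m) (trans (sym (flaws≡failures m (above e a))) above-flaws) ⟩
    k + m                       ≡⟨ +-comm k m ⟩
    m + k                       ≡⟨ above-length ⟨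
    length (above e a)          ∎)
  final≡ : finalState (emptyLot n) a ≡ finalState l (below e a) ++ false ∷ replicate m true
  final≡ = begin
    finalState (emptyLot n) a
      ≡⟨ cong (λ st → finalState st a) (emptyLot-split d<n) ⟩
    finalState (l ++ false ∷ r) a
      ≡⟨ proj₂ decomposition ⟩
    finalState l (below e a) ++ false ∷ finalState r (above e a)
      ≡⟨ cong (λ st → finalState l (below e a) ++ false ∷ st) right-full ⟩
    finalState l (below e a) ++ false ∷ replicate m true ∎
  |left|≡d : length (finalState l (below e a)) ≡ d
  |left|≡d = length-finalState-emptyLot d (below e a)

lastGap⇒splitsAt : ∀ n k d a → suc d ≤ n → flaws n a ≡ k → LastGap n d a → SplitsAt n k d a
lastGap⇒splitsAt n k d a d<n flaws≡k (l₀ , |l₀|≡d , final≡) = record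
  { avoids = proj₁ gapEmpty
  ; below-parks = trans (flaws≡failures d (below e a)) (proj₂ gapEmpty)
  ; above-flaws = trans (flaws≡failures m (above e a)) failures-above
  ; above-length = trans (finalState-full⇒length m (above e a) right-full) (trans (cong (_+ m) failures-above) (+-comm k m))
  }
  where
  open ≡-Reasoning
  e = suc d
  m = n ∸ suc d
  l = emptyLot d
  r = emptyLot m
  lot≡ = emptyLot-split d<n
  gapEmpty : Avoids e a × failures l (below e a) ≡ 0
  gapEmpty = gap-staysEmpty⇒ d l r a (length-replicate d) (begin
    occupied (finalState (l ++ false ∷ r) a) d             ≡⟨ cong (λ st → occupied (finalState st a) d) lot≡ ⟨
    occupied (finalState (emptyLot n) a) d                 ≡⟨ cong (λ st → occupied st d) final≡ ⟩
    occupied (l₀ ++ false ∷ replicate m true) d            ≡⟨ cong (occupied (l₀ ++ false ∷ replicate m true)) |l₀|≡d ⟨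
    occupied (l₀ ++ false ∷ replicate m true) (length l₀)  ≡⟨ occupied-++ l₀ false _ ⟩
    false                                                  ∎)
  decomposition = gap-decomposition d l r a (length-replicate d) (proj₁ gapEmpty) (proj₂ gapEmpty)
  failures-above : failures r (above e a) ≡ k
  failures-above = begin
    failures r (above e a)       ≡⟨ proj₁ decomposition ⟨
    failures (l ++ false ∷ r) a  ≡⟨ cong (λ st → failures st a) lot≡ ⟨
    failures (emptyLot n) a      ≡⟨ flaws≡failures n a ⟨
    flaws n a                    ≡⟨ flaws≡k ⟩
    k                            ∎
  right-full : finalState r (above e a) ≡ replicate m true
  right-full = ++-∷-cancelˡ (finalState l (below e a)) l₀
    (trans (length-finalState-emptyLot d (below e a)) (sym |l₀|≡d))
    (trans (sym (proj₂ decomposition)) (trans (cong (λ st → finalState st a) (sym lot≡)) final≡))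

lastGap-unique : ∀ {n d d′ a} → LastGap n d a → LastGap n d′ a → d ≡ d′
lastGap-unique (l , |l|≡d , final≡) (l′ , |l′|≡d′ , final≡′) =
  trans (sym |l|≡d) (trans (lastFalse-unique l l′ (trans (sym final≡) final≡′)) |l′|≡d′)

finalState-notFull : ∀ n a → length a ≡ n → 1 ≤ flaws n a →
                     occupancy (finalState (emptyLot n) a) < length (finalState (emptyLot n) a)
finalState-notFull n a |a|≡n 1≤flaws = begin-strict
  occupancy final                            <⟨ m<n+m _ 1≤flaws ⟩
  flaws n a + occupancy final                ≡⟨ cong (_+ occupancy final) (flaws≡failures n a) ⟩
  failures (emptyLot n) a + occupancy final  ≡⟨ failures+occupancy-emptyLot n a ⟩
  length a                                   ≡⟨ |a|≡n ⟩
  n                                          ≡⟨ length-finalState-emptyLot n a ⟨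
  length final                               ∎
  where
  open ≤-Reasoning
  final = finalState (emptyLot n) a

lastGap-exists : ∀ n a → length a ≡ n → 1 ≤ flaws n a → ∃[ d ] suc d ≤ n × LastGap n d a
lastGap-exists n a |a|≡n 1≤flaws with lastFalse (finalState (emptyLot n) a) (finalState-notFull n a |a|≡n 1≤flaws)
... | l , m , final≡ = length l , d<n , l , refl , subst (λ i → final ≡ l ++ false ∷ replicate i true) m≡ final≡
  where
  final = finalState (emptyLot n) a
  n≡ : n ≡ length l + suc m
  n≡ = trans (sym (length-finalState-emptyLot n a))
             (trans (cong length final≡) (trans (length-++ l) (cong (λ i → length l + suc i) (length-replicate m))))
  d<n : suc (length l) ≤ n
  d<n = subst (suc (length l) ≤_) (sym (trans n≡ (+-suc (length l) m))) (s≤s (m≤m+n (length l) m))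
  m≡ : m ≡ n ∸ suc (length l)
  m≡ = sym (trans (cong (_∸ suc (length l)) (trans n≡ (+-suc (length l) m))) (m+n∸m≡n (suc (length l)) m))

splitsAt-range : ∀ n k d s a → suc d ≤ n → length a ≡ n → All (Letter s) a → 1 ≤ k → SplitsAt n k d a →
                 k ≤ suc d × suc d < s
splitsAt-range n k d s a d<n |a|≡n a∈s 1≤k split = k≤1+d , 1+d<s
  where
  open SplitsAt split
  m = n ∸ suc d
  k≤1+d : k ≤ suc d
  k≤1+d = +-cancelʳ-≤ m k (suc d) (begin
    k + m                                     ≡⟨ +-comm k m ⟩
    m + k                                     ≡⟨ above-length ⟨
    length (above (suc d) a)                  ≤⟨ m≤n+m _ (length (below (suc d) a)) ⟩
    length (below (suc d) a) + length (above (suc d) a) ≡⟨ length-below+above (suc d) a avoids ⟩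
    length a                                  ≡⟨ |a|≡n ⟩
    n                                         ≡⟨ m+[n∸m]≡n d<n ⟨
    suc d + m                                 ∎)
    where open ≤-Reasoning
  1+d<s : suc d < s
  1+d<s with suc d <? s
  ... | yes 1+d<s = 1+d<s
  ... | no 1+d≮s = contradiction (begin
    1                         ≤⟨ 1≤k ⟩
    k                         ≤⟨ m≤n+m k m ⟩
    m + k                     ≡⟨ above-length ⟨
    length (above (suc d) a)  ≡⟨ cong length (above-≤ (suc d) a (All.map (λ x∈s → ≤-trans (proj₂ x∈s) (≮⇒≥ 1+d≮s)) a∈s)) ⟩
    0                         ∎) λ ()
    where open ≤-Reasoning

-- Summation over the last empty space

i≤s∸k⇒i<s : ∀ {s k i} → 1 ≤ k → 1 ≤ i → i ≤ s ∸ k → i < s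
i≤s∸k⇒i<s {zero} {k} 1≤k 1≤i i≤s∸k = contradiction (≤-trans 1≤i (≤-trans i≤s∸k (≤-reflexive (0∸n≡0 k)))) λ ()
i≤s∸k⇒i<s {suc s} 1≤k 1≤i i≤s∸k = s≤s (≤-trans i≤s∸k (∸-monoʳ-≤ (suc s) 1≤k))

suc[s∸i∸1]≡s∸i : ∀ {s i} → i < s → suc (s ∸ i ∸ 1) ≡ s ∸ i
suc[s∸i∸1]≡s∸i i<s = m+[n∸m]≡n (m<n⇒0<n∸m i<s)

suc[s∸i∸1]≤n : ∀ {n s k i} → s ≤ n → 1 ≤ k → 1 ≤ i → i ≤ s ∸ k → suc (s ∸ i ∸ 1) ≤ n
suc[s∸i∸1]≤n {s = s} {i = i} s≤n 1≤k 1≤i i≤s∸k =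
  ≤-trans (≤-reflexive (suc[s∸i∸1]≡s∸i (i≤s∸k⇒i<s 1≤k 1≤i i≤s∸k))) (≤-trans (m∸n≤m s i) s≤n)

sumFrom1-gapWeight-≢k : ∀ n s k a → s ≤ n → 1 ≤ k → flaws n a ≢ k →
                        sumFrom1 (s ∸ k) (λ i → gapWeight n k (s ∸ i ∸ 1) a) ≡ 0
sumFrom1-gapWeight-≢k n s k a s≤n 1≤k flaws≢k = sumFrom1-zero (s ∸ k) λ i 1≤i i≤s∸k →
  decidable-stable (gapWeight n k (s ∸ i ∸ 1) a ≟ 0) λ w≢0 →
    flaws≢k (proj₁ (splitsAt⇒lastGap n k _ a (suc[s∸i∸1]≤n s≤n 1≤k 1≤i i≤s∸k) (gapWeight-≢0 n k _ a w≢0)))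

sumFrom1-gapWeight-≡k : ∀ n s k a → s ≤ n → 1 ≤ k → length a ≡ n → All (Letter s) a → flaws n a ≡ k →
                        sumFrom1 (s ∸ k) (λ i → gapWeight n k (s ∸ i ∸ 1) a) ≡ 1
sumFrom1-gapWeight-≡k n s k a s≤n 1≤k |a|≡n a∈s flaws≡k
  with lastGap-exists n a |a|≡n (subst (1 ≤_) (sym flaws≡k) 1≤k)
... | d , d<n , lastGap = sumFrom1-single (s ∸ k) (s ∸ suc d) 1≤i₀ i₀≤s∸k weight₀≡1 others
  where
  split = lastGap⇒splitsAt n k d a d<n flaws≡k lastGap
  range = splitsAt-range n k d s a d<n |a|≡n a∈s 1≤k split
  1≤i₀ : 1 ≤ s ∸ suc d
  1≤i₀ = m<n⇒0<n∸m (proj₂ range)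
  i₀≤s∸k : s ∸ suc d ≤ s ∸ k
  i₀≤s∸k = ∸-monoʳ-≤ s (proj₁ range)
  weight₀≡1 : gapWeight n k (s ∸ (s ∸ suc d) ∸ 1) a ≡ 1
  weight₀≡1 = subst (λ d′ → gapWeight n k d′ a ≡ 1) (sym (cong (_∸ 1) (m∸[m∸n]≡n (<⇒≤ (proj₂ range)))))
                    (gapWeight-≡1 n k d a split)
  others : ∀ i → 1 ≤ i → i ≤ s ∸ k → i ≢ s ∸ suc d → gapWeight n k (s ∸ i ∸ 1) a ≡ 0
  others i 1≤i i≤s∸k i≢i₀ = decidable-stable (gapWeight n k (s ∸ i ∸ 1) a ≟ 0) λ w≢0 → i≢i₀ (begin
    i                      ≡⟨ m∸[m∸n]≡n (<⇒≤ i<s) ⟨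
    s ∸ (s ∸ i)            ≡⟨ cong (s ∸_) (suc[s∸i∸1]≡s∸i i<s) ⟨
    s ∸ suc (s ∸ i ∸ 1)    ≡⟨ cong (λ d′ → s ∸ suc d′) (lastGap-unique {n} {a = a} (lastGapAt w≢0) lastGap) ⟩
    s ∸ suc d              ∎)
    where
    open ≡-Reasoning
    i<s = i≤s∸k⇒i<s 1≤k 1≤i i≤s∸k
    lastGapAt : gapWeight n k (s ∸ i ∸ 1) a ≢ 0 → LastGap n (s ∸ i ∸ 1) a
    lastGapAt w≢0 =
      proj₂ (splitsAt⇒lastGap n k _ a (suc[s∸i∸1]≤n s≤n 1≤k 1≤i i≤s∸k) (gapWeight-≢0 n k _ a w≢0))

indicator-flaws≡sumFrom1 : ∀ n s k a → s ≤ n → 1 ≤ k → length a ≡ n → All (Letter s) a →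
  indicator (flaws n a ≟ k) ≡ sumFrom1 (s ∸ k) (λ i → gapWeight n k (s ∸ i ∸ 1) a)
indicator-flaws≡sumFrom1 n s k a s≤n 1≤k |a|≡n a∈s with flaws n a ≟ k
... | yes flaws≡k = sym (sumFrom1-gapWeight-≡k n s k a s≤n 1≤k |a|≡n a∈s flaws≡k)
... | no flaws≢k = sym (sumFrom1-gapWeight-≢k n s k a s≤n 1≤k flaws≢k)

sumWords-gapWeight : ∀ n k d i → i ≤ n ∸ suc d →
  sumWords n (suc (d + i)) (gapWeight n k d) ≡
    (n C (n ∸ suc d + k)) * pjm (n ∸ (n ∸ suc d + k)) d d * pj (n ∸ suc d + k) i
sumWords-gapWeight n k d i i≤m = begin
  sumWords n (suc (d + i)) (gapWeight n k d)                  ≡⟨ sumWords-splitWeight d i n j parking kFlaws ⟩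
  (n C j) * sumWords (n ∸ j) d parking * sumWords j i kFlaws  ≡⟨ cong₂ (λ x y → (n C j) * x * y) left right ⟩
  (n C j) * pjm (n ∸ j) d d * pj j i                          ∎
  where
  open ≡-Reasoning
  m = n ∸ suc d
  j = m + k
  parking kFlaws : List ℕ → ℕ
  parking l = indicator (flaws d l ≟ 0)
  kFlaws r = indicator (flaws m r ≟ k)
  left : sumWords (n ∸ j) d parking ≡ pjm (n ∸ j) d d
  left = sym (trans (length-filter-seqs (n ∸ j) (d ⊓ d) (λ l → flaws d l ≟ 0))
                    (cong (λ t → sumWords (n ∸ j) t parking) (⊓-idem d)))
  right : sumWords j i kFlaws ≡ pj j i
  right = sym (begin
    pj j i
      ≡⟨ length-filter-seqs j (i ⊓ j) (λ r → flaws j r ≟ 0) ⟩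
    sumWords j (i ⊓ j) (λ r → indicator (flaws j r ≟ 0))
      ≡⟨ cong (λ t → sumWords j t (λ r → indicator (flaws j r ≟ 0))) (m≤n⇒m⊓n≡m (≤-trans i≤m (m≤m+n m k))) ⟩
    sumWords j i (λ r → indicator (flaws j r ≟ 0))
      ≡⟨ sumWords-cong j i (λ r |r|≡j r∈i →
           flaws≡k⇔parkingFunction m k r |r|≡j (All.map (λ x∈i → ≤-trans (proj₂ x∈i) i≤m) r∈i)) ⟨
    sumWords j i kFlaws ∎)

n∸[s∸i]≡n∸s+i : ∀ {n s i} → i ≤ s → s ≤ n → n ∸ (s ∸ i) ≡ n ∸ s + i
n∸[s∸i]≡n∸s+i {n} {s} {i} i≤s s≤n = begin
  n ∸ (s ∸ i)                ≡⟨ cong (_∸ (s ∸ i)) (m∸n+n≡m s≤n) ⟨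
  (n ∸ s + s) ∸ (s ∸ i)      ≡⟨ +-∸-assoc (n ∸ s) (m∸n≤m s i) ⟩
  n ∸ s + (s ∸ (s ∸ i))      ≡⟨ cong (n ∸ s +_) (m∸[m∸n]≡n i≤s) ⟩
  n ∸ s + i                  ∎
  where open ≡-Reasoning

n∸[n∸s+i+k]≡s∸i∸k : ∀ {n s} i k → s ≤ n → n ∸ (n ∸ s + i + k) ≡ s ∸ i ∸ k
n∸[n∸s+i+k]≡s∸i∸k {n} {s} i k s≤n = begin
  n ∸ (n ∸ s + i + k)        ≡⟨ cong (n ∸_) (+-assoc (n ∸ s) i k) ⟩
  n ∸ (n ∸ s + (i + k))      ≡⟨ ∸-+-assoc n (n ∸ s) (i + k) ⟨
  n ∸ (n ∸ s) ∸ (i + k)      ≡⟨ cong (_∸ (i + k)) (m∸[m∸n]≡n s≤n) ⟩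
  s ∸ (i + k)                ≡⟨ ∸-+-assoc s i k ⟨
  s ∸ i ∸ k                  ∎
  where open ≡-Reasoning

sumWords-gapWeight-summand : ∀ n s k i → s ≤ n → 1 ≤ k → 1 ≤ i → i ≤ s ∸ k →
  sumWords n s (gapWeight n k (s ∸ i ∸ 1)) ≡
    (n C (n ∸ s + i + k)) * pjm (s ∸ i ∸ k) (s ∸ i ∸ 1) (s ∸ i ∸ 1) * pj (n ∸ s + i + k) i
sumWords-gapWeight-summand n s k i s≤n 1≤k 1≤i i≤s∸k = begin
  sumWords n s (gapWeight n k d)
    ≡⟨ cong (λ t → sumWords n t (gapWeight n k d)) s≡ ⟩
  sumWords n (suc (d + i)) (gapWeight n k d)
    ≡⟨ sumWords-gapWeight n k d i (subst (i ≤_) (sym m≡) (m≤n+m i (n ∸ s))) ⟩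
  (n C (n ∸ suc d + k)) * pjm (n ∸ (n ∸ suc d + k)) d d * pj (n ∸ suc d + k) i
    ≡⟨ cong (λ m → (n C (m + k)) * pjm (n ∸ (m + k)) d d * pj (m + k) i) m≡ ⟩
  (n C (n ∸ s + i + k)) * pjm (n ∸ (n ∸ s + i + k)) d d * pj (n ∸ s + i + k) i
    ≡⟨ cong (λ t → (n C (n ∸ s + i + k)) * pjm t d d * pj (n ∸ s + i + k) i) (n∸[n∸s+i+k]≡s∸i∸k i k s≤n) ⟩
  (n C (n ∸ s + i + k)) * pjm (s ∸ i ∸ k) d d * pj (n ∸ s + i + k) i ∎
  where
  open ≡-Reasoning
  d = s ∸ i ∸ 1
  i<s = i≤s∸k⇒i<s 1≤k 1≤i i≤s∸k
  s≡ : s ≡ suc (d + i)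
  s≡ = sym (trans (cong (_+ i) (suc[s∸i∸1]≡s∸i i<s)) (m∸n+n≡m (<⇒≤ i<s)))
  m≡ : n ∸ suc d ≡ n ∸ s + i
  m≡ = trans (cong (n ∸_) (suc[s∸i∸1]≡s∸i i<s)) (n∸[s∸i]≡n∸s+i (<⇒≤ i<s) s≤n)

lemma2p1 : (n s k : ℕ) → 1 ≤ s → s ≤ n → 1 ≤ k → k ≤ s ∸ 1 →
  pnsk n s k ≡
    sumFrom1 (s ∸ k) (λ i →
      (n C (n ∸ s + i + k)) * pjm (s ∸ i ∸ k) (s ∸ i ∸ 1) (s ∸ i ∸ 1) * pj (n ∸ s + i + k) i)
lemma2p1 n s k _ s≤n 1≤k _ = begin
  pnsk n s k
    ≡⟨ length-filter-seqs n (s ⊓ n) (λ a → flaws n a ≟ k) ⟩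
  sumWords n (s ⊓ n) (λ a → indicator (flaws n a ≟ k))
    ≡⟨ cong (λ t → sumWords n t (λ a → indicator (flaws n a ≟ k))) (m≤n⇒m⊓n≡m s≤n) ⟩
  sumWords n s (λ a → indicator (flaws n a ≟ k))
    ≡⟨ sumWords-cong n s (λ a |a|≡n a∈s → indicator-flaws≡sumFrom1 n s k a s≤n 1≤k |a|≡n a∈s) ⟩
  sumWords n s (λ a → sumFrom1 (s ∸ k) (λ i → gapWeight n k (s ∸ i ∸ 1) a))
    ≡⟨ sumWords-sumFrom1 (s ∸ k) n s (λ i → gapWeight n k (s ∸ i ∸ 1)) ⟩
  sumFrom1 (s ∸ k) (λ i → sumWords n s (gapWeight n k (s ∸ i ∸ 1)))
    ≡⟨ sumFrom1-cong (s ∸ k) (λ i 1≤i i≤s∸k → sumWords-gapWeight-summand n s k i s≤n 1≤k 1≤i i≤s∸k) ⟩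
  sumFrom1 (s ∸ k) (λ i →
    (n C (n ∸ s + i + k)) * pjm (s ∸ i ∸ k) (s ∸ i ∸ 1) (s ∸ i ∸ 1) * pj (n ∸ s + i + k) i) ∎
  where open ≡-Reasoning
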